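{- Let $A$ be a finite non-empty set of agents. For every agent $a\in A$ and every formula $\varphi\in\mathcal{L}_{KS}$, $$\vdash_{\mathsf{SSL}}S_a\varphi\to\Big(K_a\varphi\wedge\varphi\wedge\bigwedge_{b\in A\setminus\{a\}}(\neg K_b\varphi\wedge\neg K_b\neg\varphi)\Big).$$
   Context: The language $\mathcal{L}_{KS}$ over a countable set $\mathsf{Prop}$ of variables and agents $A$ is $\varphi::=p\mid\neg\varphi\mid(\varphi\wedge\varphi)\mid K_a\varphi\mid S_a\varphi$ (empty conjunction is $\top$). The system $\mathsf{SSL}$ has axioms: all propositional tautologies; for each $a\in A$: (K) $K_a(\varphi\to\psi)\to(K_a\varphi\to K_a\psi)$, (T) $K_a\varphi\to\varphi$, (4) $K_a\varphi\to K_aK_a\varphi$, (5) $\neg K_a\varphi\to K_a\neg K_a\varphi$, (S1) $S_a\varphi\to K_a\varphi$, (S4) $S_a\varphi\to K_aS_a\varphi$; and for distinct $a,b\in A$: (S2) $S_a\varphi\to\neg K_b\varphi$. Rules: modus ponens; from $\varphi$ infer $K_a\varphi$; from $\vdash\varphi\leftrightarrow\psi$ infer $\vdash S_a\varphi\leftrightarrow S_a\psi$. -}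

module Defs where

open import Data.Nat using (ℕ)
open import Data.Fin using (Fin)
open import Data.Bool using (Bool; true; false; not; _∧_)
open import Data.List using (List; []; _∷_; filter; map)
open import Data.List.Base using (List)
open import Data.Fin.Properties using () renaming (_≟_ to _≟ᶠ_)
open import Data.List using (allFin) 
open import Relation.Nullary using (¬_)
open import Relation.Nullary.Decidable using (¬?)
open import Relation.Binary.PropositionalEquality using (_≡_)

data Form (n : ℕ) : Set where
  var : ℕ → Form n
  ~_  : Form n → Form n
  _&_ : Form n → Form n → Form n
  K   : Fin n → Form n → Form n
  S   : Fin n → Form n → Form n

infixr 30 ~_
infixr 25 _&_

module _ {n : ℕ} where
  infixr 20 _⇒_
  infix 15 _⇔_

  _⇒_ : Form n → Form n → Form n
  φ ⇒ ψ = ~ (φ & ~ ψ)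

  _⇔_ : Form n → Form n → Form n
  φ ⇔ ψ = (φ ⇒ ψ) & (ψ ⇒ φ)

  -- ⊤ (the empty conjunction), fixed as a tautology
  ⊤F : Form n
  ⊤F = ~ (var 0 & ~ var 0)

  ⋀ : List (Form n) → Form n
  ⋀ []       = ⊤F
  ⋀ (φ ∷ φs) = φ & ⋀ φs

  -- Propositional evaluation: variables and modal formulas K_a ψ, S_a ψ are atoms.
  eval : (Form n → Bool) → Form n → Bool
  eval v (var p)  = v (var p)
  eval v (~ φ)    = not (eval v φ)
  eval v (φ & ψ)  = eval v φ ∧ eval v ψ
  eval v (K a φ)  = v (K a φ)
  eval v (S a φ)  = v (S a φ)

  -- φ is a (substitution instance of a) propositional tautology
  Tautology : Form n → Set
  Tautology φ = ∀ (v : Form n → Bool) → eval v φ ≡ true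

data ⊢SSL {n : ℕ} : Form n → Set where
  taut : ∀ {φ} → Tautology φ → ⊢SSL φ
  axK  : ∀ a φ ψ → ⊢SSL (K a (φ ⇒ ψ) ⇒ (K a φ ⇒ K a ψ))
  axT  : ∀ a φ → ⊢SSL (K a φ ⇒ φ)
  ax4  : ∀ a φ → ⊢SSL (K a φ ⇒ K a (K a φ))
  ax5  : ∀ a φ → ⊢SSL (~ K a φ ⇒ K a (~ K a φ))
  axS1 : ∀ a φ → ⊢SSL (S a φ ⇒ K a φ)
  axS4 : ∀ a φ → ⊢SSL (S a φ ⇒ K a (S a φ))
  axS2 : ∀ a b φ → ¬ (a ≡ b) → ⊢SSL (S a φ ⇒ ~ K b φ)
  mp   : ∀ {φ ψ} → ⊢SSL (φ ⇒ ψ) → ⊢SSL φ → ⊢SSL ψ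
  nec  : ∀ a {φ} → ⊢SSL φ → ⊢SSL (K a φ)
  reS  : ∀ a {φ ψ} → ⊢SSL (φ ⇔ ψ) → ⊢SSL (S a φ ⇔ S a ψ)

othersThan : {n : ℕ} → Fin n → List (Fin n)
othersThan a = filter (λ b → ¬? (b ≟ᶠ a)) (allFin _)

-- S_a φ yields K_a φ by S1 and then φ by T. For every other agent b, S2 gives ¬K_b φ directly,
-- and ¬K_b ¬φ follows from φ because T for b turns K_b ¬φ into ¬φ.
module Submission where

open import Defs
open import Data.Nat using (ℕ; suc)
open import Data.Fin using (Fin)
open import Data.List using (map; allFin)
open import Data.Bool using (Bool; true; false; not; _∧_)
open import Data.List.Relation.Unary.All using (All; []; _∷_)
open import Data.List.Relation.Unary.All.Properties using (all-filter)
open import Relation.Nullary.Decidable using (¬?)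
open import Relation.Binary.PropositionalEquality using (_≡_; refl; _≢_; ≢-sym)
open import Data.Fin.Properties using () renaming (_≟_ to _≟ᶠ_)

module _ {n : ℕ} where

  private
    _⇒ᵇ_ : Bool → Bool → Bool
    x ⇒ᵇ y = not (x ∧ not y)

    ⇒ᵇ-&-intro : ∀ x y z → (x ⇒ᵇ y) ⇒ᵇ ((x ⇒ᵇ z) ⇒ᵇ (x ⇒ᵇ (y ∧ z))) ≡ true
    ⇒ᵇ-&-intro true  true  true  = refl
    ⇒ᵇ-&-intro true  true  false = refl
    ⇒ᵇ-&-intro true  false _     = refl
    ⇒ᵇ-&-intro false _     _     = refl

    ⇒ᵇ-trans : ∀ x y z → (x ⇒ᵇ y) ⇒ᵇ ((y ⇒ᵇ z) ⇒ᵇ (x ⇒ᵇ z)) ≡ true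
    ⇒ᵇ-trans true  true  true  = refl
    ⇒ᵇ-trans true  true  false = refl
    ⇒ᵇ-trans true  false _     = refl
    ⇒ᵇ-trans false true  true  = refl
    ⇒ᵇ-trans false true  false = refl
    ⇒ᵇ-trans false false _     = refl

    ⇒ᵇ-contra : ∀ x y z → (x ⇒ᵇ y) ⇒ᵇ ((z ⇒ᵇ not y) ⇒ᵇ (x ⇒ᵇ not z)) ≡ true
    ⇒ᵇ-contra true  true  true  = refl
    ⇒ᵇ-contra true  true  false = refl
    ⇒ᵇ-contra true  false _     = refl
    ⇒ᵇ-contra false true  true  = refl
    ⇒ᵇ-contra false true  false = refl
    ⇒ᵇ-contra false false true  = refl
    ⇒ᵇ-contra false false false = refl

    ⇒ᵇ-excluded-middle : ∀ x p → x ⇒ᵇ not (p ∧ not p) ≡ true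
    ⇒ᵇ-excluded-middle true  true  = refl
    ⇒ᵇ-excluded-middle true  false = refl
    ⇒ᵇ-excluded-middle false true  = refl
    ⇒ᵇ-excluded-middle false false = refl

  ⇒-&-intro : ∀ {χ φ ψ : Form n} → ⊢SSL (χ ⇒ φ) → ⊢SSL (χ ⇒ ψ) → ⊢SSL (χ ⇒ φ & ψ)
  ⇒-&-intro {χ} {φ} {ψ} p q =
    mp (mp (taut (λ v → ⇒ᵇ-&-intro (eval v χ) (eval v φ) (eval v ψ))) p) q

  ⇒-trans : ∀ {φ ψ χ : Form n} → ⊢SSL (φ ⇒ ψ) → ⊢SSL (ψ ⇒ χ) → ⊢SSL (φ ⇒ χ)
  ⇒-trans {φ} {ψ} {χ} p q =
    mp (mp (taut (λ v → ⇒ᵇ-trans (eval v φ) (eval v ψ) (eval v χ))) p) q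

  ⇒-contra : ∀ {χ φ ψ : Form n} → ⊢SSL (χ ⇒ φ) → ⊢SSL (ψ ⇒ ~ φ) → ⊢SSL (χ ⇒ ~ ψ)
  ⇒-contra {χ} {φ} {ψ} p q =
    mp (mp (taut (λ v → ⇒ᵇ-contra (eval v χ) (eval v φ) (eval v ψ))) p) q

  ⇒-⊤F : ∀ {χ : Form n} → ⊢SSL (χ ⇒ ⊤F)
  ⇒-⊤F {χ} = taut (λ v → ⇒ᵇ-excluded-middle (eval v χ) (eval v (var 0)))

  ⇒-⋀-intro : ∀ {A : Set} {χ : Form n} (f : A → Form n) {P : A → Set} →
              (∀ {x} → P x → ⊢SSL (χ ⇒ f x)) →
              ∀ {xs} → All P xs → ⊢SSL (χ ⇒ ⋀ (map f xs))
  ⇒-⋀-intro f prove []         = ⇒-⊤F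
  ⇒-⋀-intro f prove (px ∷ pxs) = ⇒-&-intro (prove px) (⇒-⋀-intro f prove pxs)

  S⇒self : ∀ a φ → ⊢SSL (S {n} a φ ⇒ φ)
  S⇒self a φ = ⇒-trans (axS1 a φ) (axT a φ)

  S⇒¬K¬ : ∀ a b φ → ⊢SSL (S {n} a φ ⇒ ~ K b (~ φ))
  S⇒¬K¬ a b φ = ⇒-contra (S⇒self a φ) (axT b (~ φ))

  S⇒others-ignorant : ∀ a b φ → b ≢ a → ⊢SSL (S {n} a φ ⇒ ~ K b φ & ~ K b (~ φ))
  S⇒others-ignorant a b φ b≢a = ⇒-&-intro (axS2 a b φ (≢-sym b≢a)) (S⇒¬K¬ a b φ)

othersThan-≢ : ∀ {n} (a : Fin n) → All (_≢ a) (othersThan a)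
othersThan-≢ a = all-filter (λ b → ¬? (b ≟ᶠ a)) (allFin _)

proposition4p5 : (n : ℕ) (a : Fin (suc n)) (φ : Form (suc n)) →
    ⊢SSL (S a φ ⇒ (K a φ & φ & ⋀ (map (λ b → ~ K b φ & ~ K b (~ φ)) (othersThan a))))
proposition4p5 n a φ =
  ⇒-&-intro (axS1 a φ)
    (⇒-&-intro (S⇒self a φ)
      (⇒-⋀-intro (λ b → ~ K b φ & ~ K b (~ φ)) (S⇒others-ignorant a _ φ) (othersThan-≢ a)))
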